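{- Let $p,q\geq0$ be integers and let $X_1,\ldots,X_p$ be independent real random variables all having the same moments $\mu_j=\mathrm{E}(X_i^j)$, finite for all $j\geq0$. Let $S_{p,q}=X_1+\cdots+X_p+q$. Then for every integer $n\geq0$, $$\mathrm{E}\left(S_{p,q}^n\right)=\binom{n+p}{p}^{ -1}B^{(q)}_{n+p+q,\,p+q}(1\mu_0,2\mu_1,3\mu_2,\ldots;1,1,1,\ldots).$$
   Context: For sequences $a=(a_l)_{l\geq1}$, $b=(b_l)_{l\geq1}$ and integers $N,K,r\geq0$, the partial $r$-Bell polynomial is $$B^{(r)}_{N,K}(a_1,a_2,\ldots;b_1,b_2,\ldots)=\sum_{\pi}\ \prod_{B\in\pi,\ B\cap\{1,\ldots,r\}=\emptyset}a_{|B|}\prod_{B\in\pi,\ B\cap\{1,\ldots,r\}\neq\emptyset}b_{|B|},$$ where $\pi$ ranges over the partitions of $\{1,\ldots,N\}$ into exactly $K$ nonempty blocks such that $1,\ldots,r$ lie in pairwise distinct blocks (an empty sum is $0$; the empty partition of the empty set contributes $1$). -}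

module Defs where

open import Level using (Level)
open import Algebra.Bundles using (CommutativeRing)
open import Data.Bool using (Bool; true; false; _∧_; _∨_; not; if_then_else_)
open import Data.Nat using (ℕ; zero; suc; _∸_; _≡ᵇ_; _<ᵇ_)
open import Data.Fin using (Fin; toℕ)
import Data.Fin as F
open import Data.Vec using (Vec; []; _∷_; lookup)
open import Data.List using (List; []; _∷_; map; concatMap; allFin; foldr)
open import Function using (_∘_)

allB : (n : ℕ) → (Fin n → Bool) → Bool
allB zero    f = true
allB (suc n) f = f F.zero ∧ allB n (f ∘ F.suc)

anyB : (n : ℕ) → (Fin n → Bool) → Bool
anyB zero    f = false
anyB (suc n) f = f F.zero ∨ anyB n (f ∘ F.suc)

countB : (n : ℕ) → (Fin n → Bool) → ℕ
countB zero    f = 0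
countB (suc n) f = (if f F.zero then 1 else 0) Data.Nat.+ countB n (f ∘ F.suc)

_=ᶠ_ : ∀ {n} → Fin n → Fin n → Bool
i =ᶠ j = toℕ i ≡ᵇ toℕ j

_⇒ᵇ_ : Bool → Bool → Bool
x ⇒ᵇ y = not x ∨ y

allVecs : (N K : ℕ) → List (Vec (Fin K) N)
allVecs zero    K = [] ∷ []
allVecs (suc N) K = concatMap (λ v → map (_∷ v) (allFin K)) (allVecs N K)

-- A labeling encodes a set partition of {1..N} (element i+1 ↔ index i : Fin N)
-- into exactly K nonempty blocks when it is surjective and canonical
-- (block labels numbered in order of first appearance: every label smaller
-- than the label of i already occurs before i).  This is a bijection between
-- such labelings and partitions of {1..N} into exactly K blocks.

surjectiveB : ∀ N K → Vec (Fin K) N → Bool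
surjectiveB N K v = allB K (λ β → anyB N (λ i → lookup v i =ᶠ β))

canonicalB : ∀ N K → Vec (Fin K) N → Bool
canonicalB N K v =
  allB N (λ i → allB K (λ β →
    (toℕ β <ᵇ toℕ (lookup v i)) ⇒ᵇ
      anyB N (λ j → (toℕ j <ᵇ toℕ i) ∧ (lookup v j =ᶠ β))))

separatesB : ∀ N K → ℕ → Vec (Fin K) N → Bool
separatesB N K r v =
  allB N (λ i → allB N (λ j →
    ((toℕ i <ᵇ r) ∧ (toℕ j <ᵇ r) ∧ not (i =ᶠ j)) ⇒ᵇ not (lookup v i =ᶠ lookup v j)))

isRPartitionB : ∀ N K → ℕ → Vec (Fin K) N → Bool
isRPartitionB N K r v = surjectiveB N K v ∧ canonicalB N K v ∧ separatesB N K r v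

blockSize : ∀ N K → Vec (Fin K) N → Fin K → ℕ
blockSize N K v β = countB N (λ i → lookup v i =ᶠ β)

meetsB : ∀ N K → ℕ → Vec (Fin K) N → Fin K → Bool
meetsB N K r v β = anyB N (λ i → (toℕ i <ᵇ r) ∧ (lookup v i =ᶠ β))

module _ {c ℓ : Level} (R : CommutativeRing c ℓ) where
  open CommutativeRing R

  ℕ→R : ℕ → Carrier
  ℕ→R zero    = 0#
  ℕ→R (suc n) = 1# + ℕ→R n

  pow : Carrier → ℕ → Carrier
  pow x zero    = 1#
  pow x (suc n) = x * pow x n

  sumFin : (n : ℕ) → (Fin n → Carrier) → Carrier
  sumFin zero    f = 0#
  sumFin (suc n) f = f F.zero + sumFin n (f ∘ F.suc)

  prodFin : (n : ℕ) → (Fin n → Carrier) → Carrier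
  prodFin zero    f = 1#
  prodFin (suc n) f = f F.zero * prodFin n (f ∘ F.suc)

  sumList : List Carrier → Carrier
  sumList = foldr _+_ 0#

  rWeight : ∀ N K → ℕ → (ℕ → Carrier) → (ℕ → Carrier) → Vec (Fin K) N → Carrier
  rWeight N K r a b v =
    prodFin K (λ β → if meetsB N K r v β then b (blockSize N K v β)
                                         else a (blockSize N K v β))

  -- partial r-Bell polynomial B^{(r)}_{N,K}(a_1,a_2,...; b_1,b_2,...)
  -- (a l and b l are the l-th entries; the value at index 0 is never used)
  rBell : (N K r : ℕ) → (ℕ → Carrier) → (ℕ → Carrier) → Carrier
  rBell N K r a b =
    sumList (map (λ v → if isRPartitionB N K r v then rWeight N K r a b v else 0#)
                 (allVecs N K))

{-# OPTIONS --safe #-}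
module Submission where

-- Read a sequence f as the exponential generating function Σ f k xᵏ/k!, so that the binomial
-- convolution ⋆ multiplies generating functions. By independence and the multinomial theorem,
-- E (S_{p,q}ⁿ) is the n-th term of 𝟙 ^⋆ q ⋆ μ ^⋆ p, where 𝟙 = (1, 1, …) is the moment sequence
-- of the constant 1. Removing the block of the first element gives recurrences for the r-Bell
-- polynomials: that block has some size k + 1 and weight b (k + 1) if the element is special,
-- a (k + 1) otherwise, and what remains is a partition with one block and one special element
-- fewer. For a l = l μ (l − 1), i.e. A(x) = x M(x), the recurrence without special elements is
-- solved by the divided powers (x M)ᵖ/p!, so B⁽⁰⁾_{N,p} = (N choose p) (μ ^⋆ p) (N − p), and
-- each special element multiplies by eˣ, the generating function of 𝟙. Hence
-- B⁽q⁾_{q+N,q+p} = (N choose p) (𝟙 ^⋆ q ⋆ μ ^⋆ p) (N − p); take N = n + p.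

open import Level using (Level)
open import Algebra.Bundles using (CommutativeRing)
open import Data.Bool using (Bool; true; false; _∧_; _∨_; not; if_then_else_)
open import Data.Bool.Properties using (∨-assoc; ∨-identityʳ; ∧-zeroʳ)
open import Data.Nat using (ℕ; zero; suc; _∸_; _≡ᵇ_; _<ᵇ_; s≤s)
import Data.Nat as ℕ
import Data.Nat.Properties as ℕ
open import Data.Nat.Combinatorics using (_C_; nC1≡n; k>n⇒nCk≡0; nCk+nC[k+1]≡[n+1]C[k+1])
open import Data.Fin using (Fin; zero; suc; toℕ)
open import Data.Vec using (Vec; []; _∷_; lookup)
import Data.Vec as Vec
open import Data.List using (List; []; _∷_; map; concatMap; allFin; tabulate)
import Data.List as List
open import Data.List.Properties using (map-++; map-∘; map-tabulate)
open import Function using (_∘_; id)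
open import Relation.Nullary using (yes; no)
open import Relation.Binary.PropositionalEquality as ≡ using (_≡_; cong; cong₂)
open import Defs

padWith : ∀ {a} {A : Set a} {p} → A → ∀ q → (Fin p → A) → Fin (q ℕ.+ p) → A
padWith c zero    f i       = f i
padWith c (suc q) f zero    = c
padWith c (suc q) f (suc i) = padWith c q f i

module RingArithmetic {c ℓ : Level} (R : CommutativeRing c ℓ) where
  open CommutativeRing R hiding (zero)
  open import Algebra.Properties.CommutativeSemigroup +-commutativeSemigroup using (x∙yz≈y∙xz)

  ⟦_⟧ : ℕ → Carrier
  ⟦ n ⟧ = ℕ→R R n

  ⟦⟧-+ : ∀ m n → ⟦ m ℕ.+ n ⟧ ≈ ⟦ m ⟧ + ⟦ n ⟧
  ⟦⟧-+ zero    n = sym (+-identityˡ _)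
  ⟦⟧-+ (suc m) n = trans (+-congˡ (⟦⟧-+ m n)) (sym (+-assoc _ _ _))

  ⟦suc⟧-* : ∀ n x → ⟦ suc n ⟧ * x ≈ x + ⟦ n ⟧ * x
  ⟦suc⟧-* n x = trans (distribʳ x 1# ⟦ n ⟧) (+-congʳ (*-identityˡ x))

  ⟦1⟧-* : ∀ x → ⟦ 1 ⟧ * x ≈ x
  ⟦1⟧-* x = trans (⟦suc⟧-* 0 x) (trans (+-congˡ (zeroˡ x)) (+-identityʳ x))

  prodFin-cong : ∀ n {f g : Fin n → Carrier} → (∀ i → f i ≡ g i) → prodFin R n f ≡ prodFin R n g
  prodFin-cong zero    f≡g = ≡.refl
  prodFin-cong (suc n) f≡g = cong₂ _*_ (f≡g zero) (prodFin-cong n (f≡g ∘ suc))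

  pow-cong : ∀ {x y} n → x ≈ y → pow R x n ≈ pow R y n
  pow-cong zero    x≈y = refl
  pow-cong (suc n) x≈y = *-cong x≈y (pow-cong n x≈y)

  pow-1# : ∀ n → pow R 1# n ≈ 1#
  pow-1# zero    = refl
  pow-1# (suc n) = trans (*-identityˡ _) (pow-1# n)

  sumFin-padWith-1# : ∀ {p} (X : Fin p → Carrier) q → sumFin R (q ℕ.+ p) (padWith 1# q X) ≈ sumFin R p X + ⟦ q ⟧
  sumFin-padWith-1# X zero    = sym (+-identityʳ _)
  sumFin-padWith-1# X (suc q) = trans (+-congˡ (sumFin-padWith-1# X q)) (x∙yz≈y∙xz 1# _ _)

module BinomialConvolution {c ℓ : Level} (R : CommutativeRing c ℓ) where
  open CommutativeRing R hiding (zero)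
  open import Relation.Binary.Reasoning.Setoid setoid
  open import Algebra.Properties.CommutativeSemigroup +-commutativeSemigroup using (interchange)
  open import Algebra.Properties.CommutativeSemigroup *-commutativeSemigroup using (x∙yz≈y∙xz)
  open RingArithmetic R

  Seq : Set c
  Seq = ℕ → Carrier

  infix 4 _≋_
  _≋_ : Seq → Seq → Set ℓ
  f ≋ g = ∀ k → f k ≈ g k

  𝟘 : Seq
  𝟘 _ = 0#

  infixl 6 _⊕_
  _⊕_ : Seq → Seq → Seq
  (f ⊕ g) k = f k + g k

  infixr 8 _·_
  _·_ : Carrier → Seq → Seq
  (x · f) k = x * f k

  𝟙 : Seq
  𝟙 _ = 1#

  ∂ : Seq → Seq
  ∂ f k = f (suc k)

  -- binomialSum N h = Σ_{k+l=N} (N choose k) h k l, by Pascal's rule.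
  binomialSum : ℕ → (ℕ → ℕ → Carrier) → Carrier
  binomialSum zero    h = h 0 0
  binomialSum (suc N) h = binomialSum N (λ k l → h (suc k) l) + binomialSum N (λ k l → h k (suc l))

  -- The product of exponential generating functions Σ f k xᵏ/k!; the
  -- Leibniz rule ∂ (f ⋆ g) N ≡ (∂ f ⋆ g ⊕ f ⋆ ∂ g) N holds by definition.
  infixl 7 _⋆_
  _⋆_ : Seq → Seq → Seq
  (f ⋆ g) N = binomialSum N (λ k l → f k * g l)

  binomialSum-cong : ∀ N {h h′ : ℕ → ℕ → Carrier} → (∀ k l → h k l ≈ h′ k l) →
                     binomialSum N h ≈ binomialSum N h′
  binomialSum-cong zero    h≈h′ = h≈h′ 0 0
  binomialSum-cong (suc N) h≈h′ =
    +-cong (binomialSum-cong N (λ k l → h≈h′ (suc k) l)) (binomialSum-cong N (λ k l → h≈h′ k (suc l)))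

  binomialSum-+ : ∀ N (h h′ : ℕ → ℕ → Carrier) →
                  binomialSum N (λ k l → h k l + h′ k l) ≈ binomialSum N h + binomialSum N h′
  binomialSum-+ zero    h h′ = refl
  binomialSum-+ (suc N) h h′ =
    trans (+-cong (binomialSum-+ N _ _) (binomialSum-+ N _ _)) (interchange _ _ _ _)

  binomialSum-* : ∀ N x (h : ℕ → ℕ → Carrier) → binomialSum N (λ k l → x * h k l) ≈ x * binomialSum N h
  binomialSum-* zero    x h = refl
  binomialSum-* (suc N) x h =
    trans (+-cong (binomialSum-* N x _) (binomialSum-* N x _)) (sym (distribˡ x _ _))

  binomialSum-0 : ∀ N → binomialSum N (λ _ _ → 0#) ≈ 0#
  binomialSum-0 zero    = refl
  binomialSum-0 (suc N) = trans (+-cong (binomialSum-0 N) (binomialSum-0 N)) (+-identityˡ 0#)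

  binomial-theorem : ∀ x y n → pow R (x + y) n ≈ binomialSum n (λ k l → pow R x k * pow R y l)
  binomial-theorem x y zero    = sym (*-identityˡ 1#)
  binomial-theorem x y (suc n) = begin
    (x + y) * pow R (x + y) n
      ≈⟨ *-congˡ (binomial-theorem x y n) ⟩
    (x + y) * binomialSum n (λ k l → pow R x k * pow R y l)
      ≈⟨ distribʳ _ x y ⟩
    x * binomialSum n (λ k l → pow R x k * pow R y l) + y * binomialSum n (λ k l → pow R x k * pow R y l)
      ≈⟨ +-cong (binomialSum-* n x _) (binomialSum-* n y _) ⟨
    binomialSum n (λ k l → x * (pow R x k * pow R y l)) + binomialSum n (λ k l → y * (pow R x k * pow R y l))
      ≈⟨ +-cong (binomialSum-cong n (λ k l → sym (*-assoc x _ _)))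
                (binomialSum-cong n (λ k l → x∙yz≈y∙xz y _ _)) ⟩
    binomialSum (suc n) (λ k l → pow R x k * pow R y l) ∎

  ⋆-cong : ∀ {f f′ g g′} → f ≋ f′ → g ≋ g′ → f ⋆ g ≋ f′ ⋆ g′
  ⋆-cong f≋f′ g≋g′ N = binomialSum-cong N (λ k l → *-cong (f≋f′ k) (g≋g′ l))

  ⋆-distribʳ : ∀ f g h → (f ⊕ g) ⋆ h ≋ f ⋆ h ⊕ g ⋆ h
  ⋆-distribʳ f g h N = trans (binomialSum-cong N (λ k l → distribʳ (h l) (f k) (g k))) (binomialSum-+ N _ _)

  ⋆-distribˡ : ∀ f g h → f ⋆ (g ⊕ h) ≋ f ⋆ g ⊕ f ⋆ h
  ⋆-distribˡ f g h N = trans (binomialSum-cong N (λ k l → distribˡ (f k) (g l) (h l))) (binomialSum-+ N _ _)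

  ·-⋆-assoc : ∀ x f g → (x · f) ⋆ g ≋ x · (f ⋆ g)
  ·-⋆-assoc x f g N = trans (binomialSum-cong N (λ k l → *-assoc x (f k) (g l))) (binomialSum-* N x _)

  ⋆-·-comm : ∀ x f g → f ⋆ (x · g) ≋ x · (f ⋆ g)
  ⋆-·-comm x f g N = trans (binomialSum-cong N (λ k l → x∙yz≈y∙xz (f k) x (g l))) (binomialSum-* N x _)

  ⋆-zeroˡ : ∀ g → 𝟘 ⋆ g ≋ 𝟘
  ⋆-zeroˡ g N = trans (binomialSum-cong N (λ k l → zeroˡ (g l))) (binomialSum-0 N)

  ⋆-zeroʳ : ∀ f → f ⋆ 𝟘 ≋ 𝟘
  ⋆-zeroʳ f N = trans (binomialSum-cong N (λ k l → zeroʳ (f k))) (binomialSum-0 N)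

  ⋆-comm : ∀ f g → f ⋆ g ≋ g ⋆ f
  ⋆-comm f g zero    = *-comm (f 0) (g 0)
  ⋆-comm f g (suc N) = trans (+-cong (⋆-comm (∂ f) g N) (⋆-comm f (∂ g) N)) (+-comm _ _)

  ⋆-assoc : ∀ f g h → (f ⋆ g) ⋆ h ≋ f ⋆ (g ⋆ h)
  ⋆-assoc f g h zero    = *-assoc (f 0) (g 0) (h 0)
  ⋆-assoc f g h (suc N) = begin
    ((∂ f ⋆ g ⊕ f ⋆ ∂ g) ⋆ h) N + ((f ⋆ g) ⋆ ∂ h) N
      ≈⟨ +-congʳ (⋆-distribʳ (∂ f ⋆ g) (f ⋆ ∂ g) h N) ⟩
    ((∂ f ⋆ g) ⋆ h) N + ((f ⋆ ∂ g) ⋆ h) N + ((f ⋆ g) ⋆ ∂ h) N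
      ≈⟨ +-cong (+-cong (⋆-assoc (∂ f) g h N) (⋆-assoc f (∂ g) h N)) (⋆-assoc f g (∂ h) N) ⟩
    (∂ f ⋆ (g ⋆ h)) N + (f ⋆ (∂ g ⋆ h)) N + (f ⋆ (g ⋆ ∂ h)) N
      ≈⟨ +-assoc _ _ _ ⟩
    (∂ f ⋆ (g ⋆ h)) N + ((f ⋆ (∂ g ⋆ h)) N + (f ⋆ (g ⋆ ∂ h)) N)
      ≈⟨ +-congˡ (⋆-distribˡ f (∂ g ⋆ h) (g ⋆ ∂ h) N) ⟨
    (∂ f ⋆ (g ⋆ h)) N + (f ⋆ (∂ g ⋆ h ⊕ g ⋆ ∂ h)) N ∎

  ⋆-swap : ∀ f g h → f ⋆ (g ⋆ h) ≋ g ⋆ (f ⋆ h)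
  ⋆-swap f g h N = begin
    (f ⋆ (g ⋆ h)) N ≈⟨ ⋆-assoc f g h N ⟨
    ((f ⋆ g) ⋆ h) N ≈⟨ ⋆-cong (⋆-comm f g) (λ _ → refl) N ⟩
    ((g ⋆ f) ⋆ h) N ≈⟨ ⋆-assoc g f h N ⟩
    (g ⋆ (f ⋆ h)) N ∎

  ⋆-interchange : ∀ f g h w → (f ⋆ g) ⋆ (h ⋆ w) ≋ (f ⋆ h) ⋆ (g ⋆ w)
  ⋆-interchange f g h w N = begin
    ((f ⋆ g) ⋆ (h ⋆ w)) N ≈⟨ ⋆-assoc f g (h ⋆ w) N ⟩
    (f ⋆ (g ⋆ (h ⋆ w))) N ≈⟨ ⋆-cong (λ _ → refl) (⋆-swap g h w) N ⟩
    (f ⋆ (h ⋆ (g ⋆ w))) N ≈⟨ ⋆-assoc f h (g ⋆ w) N ⟨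
    ((f ⋆ h) ⋆ (g ⋆ w)) N ∎

  -- δ p is the generating function xᵖ/p!.
  δ : ℕ → Seq
  δ zero    zero    = 1#
  δ zero    (suc k) = 0#
  δ (suc p) zero    = 0#
  δ (suc p) (suc k) = δ p k

  ⟦⟧-*-δ : ∀ p n → ⟦ n ⟧ * δ p n ≈ ⟦ p ⟧ * δ p n
  ⟦⟧-*-δ zero    zero    = refl
  ⟦⟧-*-δ zero    (suc n) = trans (zeroʳ _) (sym (zeroʳ _))
  ⟦⟧-*-δ (suc p) zero    = trans (zeroˡ _) (sym (zeroʳ _))
  ⟦⟧-*-δ (suc p) (suc n) = begin
    ⟦ suc n ⟧ * δ p n     ≈⟨ ⟦suc⟧-* n _ ⟩
    δ p n + ⟦ n ⟧ * δ p n ≈⟨ +-congˡ (⟦⟧-*-δ p n) ⟩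
    δ p n + ⟦ p ⟧ * δ p n ≈⟨ ⟦suc⟧-* p _ ⟨
    ⟦ suc p ⟧ * δ p n     ∎

  -- For p ≥ N the index N ∸ suc p is truncated, but then the coefficient vanishes.
  C-*-shift : ∀ N p (g : Seq) → ⟦ N C suc p ⟧ * g (suc (N ∸ suc p)) ≈ ⟦ N C suc p ⟧ * g (N ∸ p)
  C-*-shift N p g with p ℕ.<? N
  ... | yes p<N = reflexive (cong (λ i → ⟦ N C suc p ⟧ * g i) (≡.sym (ℕ.+-∸-assoc 1 p<N)))
  ... | no  p≮N rewrite k>n⇒nCk≡0 {N} {suc p} (s≤s (ℕ.≮⇒≥ p≮N)) = trans (zeroˡ _) (sym (zeroˡ _))

  δ-⋆ : ∀ p g N → (δ p ⋆ g) N ≈ ⟦ N C p ⟧ * g (N ∸ p)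
  δ-⋆ zero    g zero    = *-congʳ (sym (+-identityʳ 1#))
  δ-⋆ (suc p) g zero    = refl
  δ-⋆ zero    g (suc N) = trans (+-congʳ (⋆-zeroˡ g N)) (trans (+-identityˡ _) (δ-⋆ zero (∂ g) N))
  δ-⋆ (suc p) g (suc N) = begin
    (δ p ⋆ g) N + (δ (suc p) ⋆ ∂ g) N
      ≈⟨ +-cong (δ-⋆ p g N) (δ-⋆ (suc p) (∂ g) N) ⟩
    ⟦ N C p ⟧ * g (N ∸ p) + ⟦ N C suc p ⟧ * g (suc (N ∸ suc p))
      ≈⟨ +-congˡ (C-*-shift N p g) ⟩
    ⟦ N C p ⟧ * g (N ∸ p) + ⟦ N C suc p ⟧ * g (N ∸ p)
      ≈⟨ distribʳ _ _ _ ⟨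
    (⟦ N C p ⟧ + ⟦ N C suc p ⟧) * g (N ∸ p)
      ≈⟨ *-congʳ (⟦⟧-+ (N C p) _) ⟨
    ⟦ N C p ℕ.+ N C suc p ⟧ * g (N ∸ p)
      ≡⟨ cong (λ m → ⟦ m ⟧ * g (N ∸ p)) (nCk+nC[k+1]≡[n+1]C[k+1] N p) ⟩
    ⟦ suc N C suc p ⟧ * g (N ∸ p) ∎

  ⋆-identityˡ : ∀ g → δ 0 ⋆ g ≋ g
  ⋆-identityˡ g N = trans (δ-⋆ 0 g N) (⟦1⟧-* (g N))

  δ₁-⋆ : ∀ g N → (δ 1 ⋆ g) N ≈ ⟦ N ⟧ * g (N ∸ 1)
  δ₁-⋆ g N = trans (δ-⋆ 1 g N) (reflexive (cong (λ m → ⟦ m ⟧ * g (N ∸ 1)) (nC1≡n N)))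

  δ₁-⋆-δ : ∀ p → δ 1 ⋆ δ p ≋ ⟦ suc p ⟧ · δ (suc p)
  δ₁-⋆-δ p zero    = trans (zeroˡ _) (sym (zeroʳ _))
  δ₁-⋆-δ p (suc N) = trans (δ₁-⋆ (δ p) (suc N)) (⟦⟧-*-δ (suc p) (suc N))

  ⋆-product : (m : ℕ) → (Fin m → Seq) → Seq
  ⋆-product zero    ρ = δ 0
  ⋆-product (suc m) ρ = ρ zero ⋆ ⋆-product m (ρ ∘ suc)

  infixr 9 _^⋆_
  _^⋆_ : Seq → ℕ → Seq
  f ^⋆ p = ⋆-product p (λ _ → f)

  ∂-^⋆ : ∀ f p → ∂ (f ^⋆ suc p) ≋ ⟦ suc p ⟧ · (∂ f ⋆ f ^⋆ p)
  ∂-^⋆ f zero    k = begin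
    (∂ f ⋆ δ 0) k + (f ⋆ 𝟘) k ≈⟨ +-congˡ (⋆-zeroʳ f k) ⟩
    (∂ f ⋆ δ 0) k + 0#        ≈⟨ +-identityʳ _ ⟩
    (∂ f ⋆ δ 0) k             ≈⟨ ⟦1⟧-* _ ⟨
    ⟦ 1 ⟧ * (∂ f ⋆ δ 0) k     ∎
  ∂-^⋆ f (suc p) k = begin
    (∂ f ⋆ f ^⋆ suc p) k + (f ⋆ ∂ (f ^⋆ suc p)) k
      ≈⟨ +-congˡ (⋆-cong (λ _ → refl) (∂-^⋆ f p) k) ⟩
    (∂ f ⋆ f ^⋆ suc p) k + (f ⋆ ⟦ suc p ⟧ · (∂ f ⋆ f ^⋆ p)) k
      ≈⟨ +-congˡ (⋆-·-comm ⟦ suc p ⟧ f _ k) ⟩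
    (∂ f ⋆ f ^⋆ suc p) k + ⟦ suc p ⟧ * (f ⋆ (∂ f ⋆ f ^⋆ p)) k
      ≈⟨ +-congˡ (*-congˡ (⋆-swap f (∂ f) (f ^⋆ p) k)) ⟩
    (∂ f ⋆ f ^⋆ suc p) k + ⟦ suc p ⟧ * (∂ f ⋆ f ^⋆ suc p) k
      ≈⟨ ⟦suc⟧-* (suc p) _ ⟨
    ⟦ suc (suc p) ⟧ * (∂ f ⋆ f ^⋆ suc p) k ∎

  -- γ f p is the divided power (x F)ᵖ/p!, where F is the generating function of f.
  γ : Seq → ℕ → Seq
  γ f p = δ p ⋆ f ^⋆ p

  ∂-γ : ∀ f p → ∂ (δ 1 ⋆ f) ⋆ γ f p ≋ ∂ (γ f (suc p))
  ∂-γ f p N = begin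
    ((δ 0 ⋆ f ⊕ δ 1 ⋆ ∂ f) ⋆ γ f p) N
      ≈⟨ ⋆-cong (λ k → +-congʳ (⋆-identityˡ f k)) (λ _ → refl) N ⟩
    ((f ⊕ δ 1 ⋆ ∂ f) ⋆ (δ p ⋆ f ^⋆ p)) N
      ≈⟨ ⋆-distribʳ f (δ 1 ⋆ ∂ f) _ N ⟩
    (f ⋆ (δ p ⋆ f ^⋆ p)) N + ((δ 1 ⋆ ∂ f) ⋆ (δ p ⋆ f ^⋆ p)) N
      ≈⟨ +-cong (⋆-swap f (δ p) (f ^⋆ p) N) (⋆-interchange (δ 1) (∂ f) (δ p) (f ^⋆ p) N) ⟩
    (δ p ⋆ f ^⋆ suc p) N + ((δ 1 ⋆ δ p) ⋆ (∂ f ⋆ f ^⋆ p)) N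
      ≈⟨ +-congˡ (⋆-cong (δ₁-⋆-δ p) (λ _ → refl) N) ⟩
    (δ p ⋆ f ^⋆ suc p) N + ((⟦ suc p ⟧ · δ (suc p)) ⋆ (∂ f ⋆ f ^⋆ p)) N
      ≈⟨ +-congˡ (·-⋆-assoc ⟦ suc p ⟧ (δ (suc p)) _ N) ⟩
    (δ p ⋆ f ^⋆ suc p) N + ⟦ suc p ⟧ * (δ (suc p) ⋆ (∂ f ⋆ f ^⋆ p)) N
      ≈⟨ +-congˡ (⋆-·-comm ⟦ suc p ⟧ (δ (suc p)) _ N) ⟨
    (δ p ⋆ f ^⋆ suc p) N + (δ (suc p) ⋆ ⟦ suc p ⟧ · (∂ f ⋆ f ^⋆ p)) N
      ≈⟨ +-congˡ (⋆-cong (λ _ → refl) (∂-^⋆ f p) N) ⟨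
    (δ p ⋆ f ^⋆ suc p) N + (δ (suc p) ⋆ ∂ (f ^⋆ suc p)) N ∎

  -- The moments of X₁ + ⋯ + X_p + q when every Xᵢ has moments f; 𝟙 is the moment
  -- sequence of the constant 1.
  shiftedMoments : Seq → ℕ → ℕ → Seq
  shiftedMoments f p q = ⋆-product (q ℕ.+ p) (padWith 𝟙 q (λ _ → f))

module Expectation {a ℓa k ℓk : Level} (A : CommutativeRing a ℓa) (K : CommutativeRing k ℓk) where
  private module A = CommutativeRing A
  private module ⋆A = BinomialConvolution A
  private module ArithA = RingArithmetic A
  open CommutativeRing K hiding (zero)
  open BinomialConvolution K
  open import Relation.Binary.Reasoning.Setoid setoid
  open import Algebra.Properties.Group +-group using (identityˡ-unique)

  module _ (E : A.Carrier → Carrier)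
           (E-cong : ∀ x y → x A.≈ y → E x ≈ E y)
           (E-+ : ∀ x y → E (x A.+ y) ≈ E x + E y) where

    E-0 : E A.0# ≈ 0#
    E-0 = identityˡ-unique (E A.0#) (E A.0#) (trans (sym (E-+ A.0# A.0#)) (E-cong _ _ (A.+-identityˡ A.0#)))

    E-binomialSum : ∀ N h → E (⋆A.binomialSum N h) ≈ binomialSum N (λ k l → E (h k l))
    E-binomialSum zero    h = refl
    E-binomialSum (suc N) h = trans (E-+ _ _) (+-cong (E-binomialSum N _) (E-binomialSum N _))

  -- Generalising over E and c lets the induction apply the hypothesis to
  -- x ↦ E (Z₀ᵏ * x), whose moments carry the extra factor ρ₀ k.
  E-pow-sum : ∀ m (Z : Fin m → A.Carrier) (ρ : Fin m → Seq) (E : A.Carrier → Carrier) →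
              (∀ x y → x A.≈ y → E x ≈ E y) → (∀ x y → E (x A.+ y) ≈ E x + E y) → (c : Carrier) →
              (∀ (j : Fin m → ℕ) → E (prodFin A m (λ i → pow A (Z i) (j i))) ≈ c * prodFin K m (λ i → ρ i (j i))) →
              ∀ n → E (pow A (sumFin A m Z) n) ≈ c * ⋆-product m ρ n
  E-pow-sum zero    Z ρ E E-cong E-+ c moments zero    = moments (λ ())
  E-pow-sum zero    Z ρ E E-cong E-+ c moments (suc n) =
    trans (E-cong _ _ (A.zeroˡ _)) (trans (E-0 E E-cong E-+) (sym (zeroʳ c)))
  E-pow-sum (suc m) Z ρ E E-cong E-+ c moments n = begin
    E (pow A (Z₀ A.+ Σ) n)
      ≈⟨ E-cong _ _ (⋆A.binomial-theorem Z₀ Σ n) ⟩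
    E (⋆A.binomialSum n (λ k l → pow A Z₀ k A.* pow A Σ l))
      ≈⟨ E-binomialSum E E-cong E-+ n _ ⟩
    binomialSum n (λ k l → E (pow A Z₀ k A.* pow A Σ l))
      ≈⟨ binomialSum-cong n (λ k l → E-pow-sum m (Z ∘ suc) (ρ ∘ suc) (λ x → E (pow A Z₀ k A.* x))
             (λ x y x≈y → E-cong _ _ (A.*-congˡ x≈y))
             (λ x y → trans (E-cong _ _ (A.distribˡ _ x y)) (E-+ _ _))
             (c * ρ zero k)
             (λ j → trans (moments (λ { zero → k ; (suc i) → j i })) (sym (*-assoc _ _ _))) l) ⟩
    binomialSum n (λ k l → (c * ρ zero k) * ⋆-product m (ρ ∘ suc) l)
      ≈⟨ binomialSum-cong n (λ k l → *-assoc _ _ _) ⟩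
    binomialSum n (λ k l → c * (ρ zero k * ⋆-product m (ρ ∘ suc) l))
      ≈⟨ binomialSum-* n c _ ⟩
    c * ⋆-product (suc m) ρ n ∎
    where
    Z₀ = Z zero
    Σ = sumFin A m (Z ∘ suc)

  E-pow-shifted-sum : (E : A.Carrier → Carrier) →
    (∀ x y → x A.≈ y → E x ≈ E y) → (∀ x y → E (x A.+ y) ≈ E x + E y) →
    ∀ p q (X : Fin p → A.Carrier) (μ : Seq) →
    (∀ (j : Fin p → ℕ) → E (prodFin A p (λ i → pow A (X i) (j i))) ≈ prodFin K p (λ i → μ (j i))) →
    ∀ n → E (pow A (sumFin A p X A.+ ℕ→R A q) n) ≈ shiftedMoments μ p q n
  E-pow-shifted-sum E E-cong E-+ p q X μ indep n = begin
    E (pow A (sumFin A p X A.+ ℕ→R A q) n)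
      ≈⟨ E-cong _ _ (ArithA.pow-cong n (A.sym (ArithA.sumFin-padWith-1# X q))) ⟩
    E (pow A (sumFin A (q ℕ.+ p) (padWith A.1# q X)) n)
      ≈⟨ E-pow-sum (q ℕ.+ p) (padWith A.1# q X) (padWith 𝟙 q (λ _ → μ)) E E-cong E-+ 1# (padded-moments q) n ⟩
    1# * shiftedMoments μ p q n
      ≈⟨ *-identityˡ _ ⟩
    shiftedMoments μ p q n ∎
    where
    padded-moments : ∀ q (j : Fin (q ℕ.+ p) → ℕ) →
      E (prodFin A (q ℕ.+ p) (λ i → pow A (padWith A.1# q X i) (j i))) ≈
      1# * prodFin K (q ℕ.+ p) (λ i → padWith 𝟙 q (λ _ → μ) i (j i))
    padded-moments zero    j = trans (indep j) (sym (*-identityˡ _))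
    padded-moments (suc q) j = begin
      E (pow A A.1# (j zero) A.* prodFin A (q ℕ.+ p) (λ i → pow A (padWith A.1# q X i) (j (suc i))))
        ≈⟨ E-cong _ _ (A.trans (A.*-congʳ (ArithA.pow-1# (j zero))) (A.*-identityˡ _)) ⟩
      E (prodFin A (q ℕ.+ p) (λ i → pow A (padWith A.1# q X i) (j (suc i))))
        ≈⟨ padded-moments q (j ∘ suc) ⟩
      1# * prodFin K (q ℕ.+ p) (λ i → padWith 𝟙 q (λ _ → μ) i (j (suc i)))
        ≈⟨ *-congˡ (*-identityˡ _) ⟨
      1# * (1# * prodFin K (q ℕ.+ p) (λ i → padWith 𝟙 q (λ _ → μ) i (j (suc i)))) ∎

module Labellings where
  open ≡ using (refl; sym; trans)
  open ≡.≡-Reasoning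

  allB-cong : ∀ n {f g : Fin n → Bool} → (∀ i → f i ≡ g i) → allB n f ≡ allB n g
  allB-cong zero    f≡g = refl
  allB-cong (suc n) f≡g = cong₂ _∧_ (f≡g zero) (allB-cong n (f≡g ∘ suc))

  allB-true : ∀ n → allB n (λ _ → true) ≡ true
  allB-true zero    = refl
  allB-true (suc n) = allB-true n

  anyB-false : ∀ n → anyB n (λ _ → false) ≡ false
  anyB-false zero    = refl
  anyB-false (suc n) = anyB-false n

  allB-∧ : ∀ n (f g : Fin n → Bool) → allB n (λ i → f i ∧ g i) ≡ allB n f ∧ allB n g
  allB-∧ zero    f g = refl
  allB-∧ (suc n) f g =
    trans (cong ((f zero ∧ g zero) ∧_) (allB-∧ n (f ∘ suc) (g ∘ suc))) (interchange (f zero) (g zero) _ _)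
    where
    interchange : ∀ w x y z → (w ∧ x) ∧ (y ∧ z) ≡ (w ∧ y) ∧ (x ∧ z)
    interchange true  true  y z = refl
    interchange true  false y z = sym (∧-zeroʳ y)
    interchange false x     y z = refl

  ≡ᵇ-sym : ∀ m n → (m ≡ᵇ n) ≡ (n ≡ᵇ m)
  ≡ᵇ-sym zero    zero    = refl
  ≡ᵇ-sym zero    (suc n) = refl
  ≡ᵇ-sym (suc m) zero    = refl
  ≡ᵇ-sym (suc m) (suc n) = ≡ᵇ-sym m n

  countTrue : ∀ {N} → Vec Bool N → ℕ
  countTrue []          = 0
  countTrue (true  ∷ S) = suc (countTrue S)
  countTrue (false ∷ S) = countTrue S

  countFalse : ∀ {N} → Vec Bool N → ℕ
  countFalse []          = 0
  countFalse (true  ∷ S) = countFalse S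
  countFalse (false ∷ S) = suc (countFalse S)

  -- merge S u puts the positions marked by S into block 0 and labels the
  -- others, in order, by u shifted up by one; every labelling in
  -- Vec (Fin (suc K)) N arises exactly once.
  merge : ∀ {N K} (S : Vec Bool N) → Vec (Fin K) (countFalse S) → Vec (Fin (suc K)) N
  merge []          []      = []
  merge (true  ∷ S) u       = zero ∷ merge S u
  merge (false ∷ S) (y ∷ u) = suc y ∷ merge S u

  avoids : ℕ → ∀ {N} → Vec Bool N → Bool
  avoids zero    S           = true
  avoids (suc r) []          = true
  avoids (suc r) (true  ∷ S) = false
  avoids (suc r) (false ∷ S) = avoids r S

  countTrue-falses : ∀ r {m} (S : Vec Bool m) → countTrue (Vec.replicate r false Vec.++ S) ≡ countTrue S
  countTrue-falses zero    S = refl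
  countTrue-falses (suc r) S = countTrue-falses r S

  countFalse-falses : ∀ r {m} (S : Vec Bool m) → countFalse (Vec.replicate r false Vec.++ S) ≡ r ℕ.+ countFalse S
  countFalse-falses zero    S = refl
  countFalse-falses (suc r) S = cong suc (countFalse-falses r S)

  anyB-merge-suc : ∀ {N K} (S : Vec Bool N) (u : Vec (Fin K) (countFalse S)) (β : Fin K) →
    anyB N (λ i → lookup (merge S u) i =ᶠ suc β) ≡ anyB (countFalse S) (λ i → lookup u i =ᶠ β)
  anyB-merge-suc []          []      β = refl
  anyB-merge-suc (true  ∷ S) u       β = anyB-merge-suc S u β
  anyB-merge-suc (false ∷ S) (y ∷ u) β = cong ((y =ᶠ β) ∨_) (anyB-merge-suc S u β)

  surjective-merge : ∀ {N K} (S : Vec Bool N) (u : Vec (Fin K) (countFalse S)) →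
    surjectiveB (suc N) (suc K) (zero ∷ merge S u) ≡ surjectiveB (countFalse S) K u
  surjective-merge {K = K} S u = allB-cong K (anyB-merge-suc S u)

  -- Canonicity when the labels in P count as already used; canonicalB is the case P = λ _ → false.
  canonicalGiven : ∀ {N K} → (Fin K → Bool) → Vec (Fin K) N → Bool
  canonicalGiven {N} {K} P v = allB N (λ i → allB K (λ β → (toℕ β <ᵇ toℕ (lookup v i)) ⇒ᵇ
    (P β ∨ anyB N (λ j → (toℕ j <ᵇ toℕ i) ∧ (lookup v j =ᶠ β)))))

  usedBelow : ∀ {K} → (Fin K → Bool) → Fin K → Bool
  usedBelow {K} P x = allB K (λ β → (toℕ β <ᵇ toℕ x) ⇒ᵇ P β)

  canonicalGiven-∷ : ∀ {N K} (P : Fin K → Bool) (x : Fin K) (w : Vec (Fin K) N) →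
    canonicalGiven P (x ∷ w) ≡ usedBelow P x ∧ canonicalGiven (λ β → P β ∨ (x =ᶠ β)) w
  canonicalGiven-∷ {N} {K} P x w = cong₂ _∧_
    (allB-cong K (λ β → cong ((toℕ β <ᵇ toℕ x) ⇒ᵇ_) (trans (cong (P β ∨_) (anyB-false N)) (∨-identityʳ (P β)))))
    (allB-cong N (λ i → allB-cong K (λ β → cong ((toℕ β <ᵇ toℕ (lookup w i)) ⇒ᵇ_) (sym (∨-assoc (P β) (x =ᶠ β) _)))))

  canonicalGiven-cong : ∀ {N K} {P Q : Fin K → Bool} (v : Vec (Fin K) N) → (∀ β → P β ≡ Q β) →
    canonicalGiven P v ≡ canonicalGiven Q v
  canonicalGiven-cong {N} {K} v P≡Q = allB-cong N (λ i → allB-cong K (λ β →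
    cong (λ z → (toℕ β <ᵇ toℕ (lookup v i)) ⇒ᵇ (z ∨ anyB N (λ j → (toℕ j <ᵇ toℕ i) ∧ (lookup v j =ᶠ β)))) (P≡Q β)))

  usedBelow-suc : ∀ {K} (P : Fin (suc K) → Bool) (y : Fin K) → P zero ≡ true → usedBelow P (suc y) ≡ usedBelow (P ∘ suc) y
  usedBelow-suc P y P₀ rewrite P₀ = refl

  canonicalGiven-merge : ∀ {N K} (P : Fin (suc K) → Bool) (S : Vec Bool N) (u : Vec (Fin K) (countFalse S)) →
    P zero ≡ true → canonicalGiven P (merge S u) ≡ canonicalGiven (P ∘ suc) u
  canonicalGiven-merge P []          []      P₀ = refl
  canonicalGiven-merge {K = K} P (true ∷ S) u P₀ = begin
    canonicalGiven P (zero ∷ merge S u)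
      ≡⟨ canonicalGiven-∷ P zero (merge S u) ⟩
    usedBelow P zero ∧ canonicalGiven (λ β → P β ∨ (zero =ᶠ β)) (merge S u)
      ≡⟨ cong (_∧ canonicalGiven (λ β → P β ∨ (zero =ᶠ β)) (merge S u)) (allB-true (suc K)) ⟩
    canonicalGiven (λ β → P β ∨ (zero =ᶠ β)) (merge S u)
      ≡⟨ canonicalGiven-merge (λ β → P β ∨ (zero =ᶠ β)) S u (cong (_∨ true) P₀) ⟩
    canonicalGiven (λ β → P (suc β) ∨ false) u
      ≡⟨ canonicalGiven-cong u (λ β → ∨-identityʳ (P (suc β))) ⟩
    canonicalGiven (P ∘ suc) u ∎
  canonicalGiven-merge P (false ∷ S) (y ∷ u) P₀ = begin
    canonicalGiven P (suc y ∷ merge S u)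
      ≡⟨ canonicalGiven-∷ P (suc y) (merge S u) ⟩
    usedBelow P (suc y) ∧ canonicalGiven (λ β → P β ∨ (suc y =ᶠ β)) (merge S u)
      ≡⟨ cong₂ _∧_ (usedBelow-suc P y P₀) (canonicalGiven-merge (λ β → P β ∨ (suc y =ᶠ β)) S u (cong (_∨ false) P₀)) ⟩
    usedBelow (P ∘ suc) y ∧ canonicalGiven (λ β → P (suc β) ∨ (y =ᶠ β)) u
      ≡⟨ canonicalGiven-∷ (P ∘ suc) y u ⟨
    canonicalGiven (P ∘ suc) (y ∷ u) ∎

  canonical-merge : ∀ {N K} (S : Vec Bool N) (u : Vec (Fin K) (countFalse S)) →
    canonicalB (suc N) (suc K) (zero ∷ merge S u) ≡ canonicalB (countFalse S) K u
  canonical-merge {N} {K} S u = begin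
    canonicalB (suc N) (suc K) (zero ∷ merge S u)
      ≡⟨ canonicalGiven-∷ (λ _ → false) zero (merge S u) ⟩
    usedBelow {suc K} (λ _ → false) zero ∧ canonicalGiven (zero =ᶠ_) (merge S u)
      ≡⟨ cong (_∧ canonicalGiven (zero =ᶠ_) (merge S u)) (allB-true (suc K)) ⟩
    canonicalGiven (zero =ᶠ_) (merge S u)
      ≡⟨ canonicalGiven-merge (zero =ᶠ_) S u refl ⟩
    canonicalB (countFalse S) K u ∎

  canonical-suc-head : ∀ {N K} (y : Fin K) (w : Vec (Fin (suc K)) N) → canonicalB (suc N) (suc K) (suc y ∷ w) ≡ false
  canonical-suc-head y w = canonicalGiven-∷ (λ _ → false) (suc y) w

  -- The `∧ true` is the shape in which separatesB unfolds at a head element.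
  notAmong : ∀ {N K} → ℕ → Fin K → Vec (Fin K) N → Bool
  notAmong {N} r x w = allB N (λ j → ((toℕ j <ᵇ r) ∧ true) ⇒ᵇ not (x =ᶠ lookup w j))

  separates-∷ : ∀ {N K} r (x : Fin K) (w : Vec (Fin K) N) →
    separatesB (suc N) K (suc r) (x ∷ w) ≡ notAmong r x w ∧ separatesB N K r w
  separates-∷ {N} {K} r x w = trans
    (cong (notAmong r x w ∧_) (trans (allB-∧ N _ _) (cong (_∧ separatesB N K r w)
      (allB-cong N (λ i → cong (λ z → ((toℕ i <ᵇ r) ∧ true) ⇒ᵇ not z) (≡ᵇ-sym (toℕ (lookup w i)) (toℕ x)))))))
    (absorb (notAmong r x w) (separatesB N K r w))
    where
    absorb : ∀ x y → x ∧ (x ∧ y) ≡ x ∧ y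
    absorb true  y = refl
    absorb false y = refl

  separates₀ : ∀ {N K} (v : Vec (Fin K) N) → separatesB N K 0 v ≡ true
  separates₀ {N} v = trans (allB-cong N (λ i → allB-true N)) (allB-true N)

  notAmong-zero-merge : ∀ {N K} r (S : Vec Bool N) (u : Vec (Fin K) (countFalse S)) →
    notAmong r zero (merge S u) ≡ avoids r S
  notAmong-zero-merge {N} zero    S           u       = allB-true N
  notAmong-zero-merge     (suc r) []          []      = refl
  notAmong-zero-merge     (suc r) (true  ∷ S) u       = refl
  notAmong-zero-merge     (suc r) (false ∷ S) (y ∷ u) = notAmong-zero-merge r S u

  notAmong-suc-merge : ∀ {N K} r (S : Vec Bool N) (u : Vec (Fin K) (countFalse S)) (y : Fin K) → avoids r S ≡ true →
    notAmong r (suc y) (merge S u) ≡ notAmong r y u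
  notAmong-suc-merge {N} zero    S           u       y _ = trans (allB-true N) (sym (allB-true (countFalse S)))
  notAmong-suc-merge     (suc r) []          []      y _ = refl
  notAmong-suc-merge     (suc r) (false ∷ S) (z ∷ u) y a = cong (not (toℕ y ≡ᵇ toℕ z) ∧_) (notAmong-suc-merge r S u y a)

  separates-merge-avoiding : ∀ {N K} r (S : Vec Bool N) (u : Vec (Fin K) (countFalse S)) → avoids r S ≡ true →
    separatesB N (suc K) r (merge S u) ≡ separatesB (countFalse S) K r u
  separates-merge-avoiding zero    S           u       _ = trans (separates₀ (merge S u)) (sym (separates₀ u))
  separates-merge-avoiding (suc r) []          []      _ = refl
  separates-merge-avoiding (suc r) (false ∷ S) (z ∷ u) a = begin
    separatesB _ _ (suc r) (suc z ∷ merge S u)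
      ≡⟨ separates-∷ r (suc z) (merge S u) ⟩
    notAmong r (suc z) (merge S u) ∧ separatesB _ _ r (merge S u)
      ≡⟨ cong₂ _∧_ (notAmong-suc-merge r S u z a) (separates-merge-avoiding r S u a) ⟩
    notAmong r z u ∧ separatesB _ _ r u
      ≡⟨ separates-∷ r z u ⟨
    separatesB _ _ (suc r) (z ∷ u) ∎

  separates-merge : ∀ {N K} r (S : Vec Bool N) (u : Vec (Fin K) (countFalse S)) →
    separatesB (suc N) (suc K) (suc r) (zero ∷ merge S u) ≡ avoids r S ∧ separatesB (countFalse S) K r u
  separates-merge r S u with avoids r S in a
  ... | true  = trans (separates-∷ r zero (merge S u))
                      (cong₂ _∧_ (trans (notAmong-zero-merge r S u) a) (separates-merge-avoiding r S u a))
  ... | false = trans (separates-∷ r zero (merge S u))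
                      (cong (_∧ separatesB _ _ r (merge S u)) (trans (notAmong-zero-merge r S u) a))

  isRPartition-merge : ∀ {N K} r (S : Vec Bool N) (u : Vec (Fin K) (countFalse S)) →
    isRPartitionB (suc N) (suc K) (suc r) (zero ∷ merge S u) ≡ avoids r S ∧ isRPartitionB (countFalse S) K r u
  isRPartition-merge r S u =
    trans (cong₂ _∧_ (surjective-merge S u) (cong₂ _∧_ (canonical-merge S u) (separates-merge r S u)))
          (rearrange (surjectiveB _ _ u) (canonicalB _ _ u) (avoids r S) (separatesB _ _ r u))
    where
    rearrange : ∀ w x y z → w ∧ x ∧ (y ∧ z) ≡ y ∧ (w ∧ x ∧ z)
    rearrange w x true  z = refl
    rearrange w x false z = trans (cong (w ∧_) (∧-zeroʳ x)) (∧-zeroʳ w)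

  isRPartition₀-merge : ∀ {N K} (S : Vec Bool N) (u : Vec (Fin K) (countFalse S)) →
    isRPartitionB (suc N) (suc K) 0 (zero ∷ merge S u) ≡ isRPartitionB (countFalse S) K 0 u
  isRPartition₀-merge S u = cong₂ _∧_ (surjective-merge S u)
    (cong₂ _∧_ (canonical-merge S u) (trans (separates₀ (zero ∷ merge S u)) (sym (separates₀ u))))

  isRPartition-suc-head : ∀ {N K} r (y : Fin K) (w : Vec (Fin (suc K)) N) →
    isRPartitionB (suc N) (suc K) r (suc y ∷ w) ≡ false
  isRPartition-suc-head r y w =
    trans (cong (λ z → surjectiveB _ _ (suc y ∷ w) ∧ (z ∧ separatesB _ _ r (suc y ∷ w))) (canonical-suc-head y w))
          (∧-zeroʳ _)

  blockSize-merge-zero : ∀ {N K} (S : Vec Bool N) (u : Vec (Fin K) (countFalse S)) →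
    blockSize N (suc K) (merge S u) zero ≡ countTrue S
  blockSize-merge-zero []          []      = refl
  blockSize-merge-zero (true  ∷ S) u       = cong suc (blockSize-merge-zero S u)
  blockSize-merge-zero (false ∷ S) (y ∷ u) = blockSize-merge-zero S u

  blockSize-merge-suc : ∀ {N K} (S : Vec Bool N) (u : Vec (Fin K) (countFalse S)) (β : Fin K) →
    blockSize N (suc K) (merge S u) (suc β) ≡ blockSize (countFalse S) K u β
  blockSize-merge-suc []          []      β = refl
  blockSize-merge-suc (true  ∷ S) u       β = blockSize-merge-suc S u β
  blockSize-merge-suc (false ∷ S) (y ∷ u) β = cong ((if y =ᶠ β then 1 else 0) ℕ.+_) (blockSize-merge-suc S u β)

  meets₀ : ∀ {N K} (v : Vec (Fin K) N) β → meetsB N K 0 v β ≡ false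
  meets₀ {N} v β = anyB-false N

  meets-merge-suc : ∀ {N K} r (S : Vec Bool N) (u : Vec (Fin K) (countFalse S)) (β : Fin K) → avoids r S ≡ true →
    meetsB N (suc K) r (merge S u) (suc β) ≡ meetsB (countFalse S) K r u β
  meets-merge-suc {N} zero    S           u       β _ = trans (anyB-false N) (sym (anyB-false (countFalse S)))
  meets-merge-suc     (suc r) []          []      β _ = refl
  meets-merge-suc     (suc r) (false ∷ S) (z ∷ u) β a = cong ((z =ᶠ β) ∨_) (meets-merge-suc r S u β a)

module SumsOverLabellings {c ℓ : Level} (R : CommutativeRing c ℓ) where
  open CommutativeRing R hiding (zero)
  open import Relation.Binary.Reasoning.Setoid setoid
  open import Algebra.Properties.Semiring.Sum semiring using (sum; sum-cong-≋; ∑-distrib-+; *-distribˡ-sum; sum-replicate-zero)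
  open import Algebra.Properties.CommutativeSemigroup +-commutativeSemigroup using (interchange)
  open BinomialConvolution R using (Seq; ∂; _⋆_)
  open Labellings

  sumList-++ : ∀ (xs ys : List Carrier) → sumList R (xs List.++ ys) ≈ sumList R xs + sumList R ys
  sumList-++ []       ys = sym (+-identityˡ _)
  sumList-++ (x ∷ xs) ys = trans (+-congˡ (sumList-++ xs ys)) (sym (+-assoc _ _ _))

  sumList-map-cong : ∀ {X : Set} {f g : X → Carrier} (xs : List X) → (∀ x → f x ≈ g x) →
                     sumList R (map f xs) ≈ sumList R (map g xs)
  sumList-map-cong []       f≈g = refl
  sumList-map-cong (x ∷ xs) f≈g = +-cong (f≈g x) (sumList-map-cong xs f≈g)

  sumList-concatMap : ∀ {X Y : Set} (f : Y → Carrier) (g : X → List Y) (xs : List X) →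
    sumList R (map f (concatMap g xs)) ≈ sumList R (map (λ x → sumList R (map f (g x))) xs)
  sumList-concatMap f g []       = refl
  sumList-concatMap f g (x ∷ xs) = begin
    sumList R (map f (g x List.++ concatMap g xs))
      ≡⟨ cong (sumList R) (map-++ f (g x) (concatMap g xs)) ⟩
    sumList R (map f (g x) List.++ map f (concatMap g xs))
      ≈⟨ sumList-++ (map f (g x)) _ ⟩
    sumList R (map f (g x)) + sumList R (map f (concatMap g xs))
      ≈⟨ +-congˡ (sumList-concatMap f g xs) ⟩
    sumList R (map (λ x → sumList R (map f (g x))) (x ∷ xs)) ∎

  sumList-tabulate : ∀ {n} (f : Fin n → Carrier) → sumList R (tabulate f) ≡ sum f
  sumList-tabulate {zero}  f = ≡.refl
  sumList-tabulate {suc n} f = cong (f zero +_) (sumList-tabulate (f ∘ suc))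

  sum-0 : ∀ {n} (f : Fin n → Carrier) → (∀ i → f i ≈ 0#) → sum f ≈ 0#
  sum-0 {n} f f≈0 = trans (sum-cong-≋ f≈0) (sum-replicate-zero n)

  sumVecs : (N K : ℕ) → (Vec (Fin K) N → Carrier) → Carrier
  sumVecs zero    K f = f []
  sumVecs (suc N) K f = sumVecs N K (λ v → sum (λ x → f (x ∷ v)))

  sumVecs-cong : ∀ N K {f g : Vec (Fin K) N → Carrier} → (∀ v → f v ≈ g v) → sumVecs N K f ≈ sumVecs N K g
  sumVecs-cong zero    K f≈g = f≈g []
  sumVecs-cong (suc N) K f≈g = sumVecs-cong N K (λ v → sum-cong-≋ (λ x → f≈g (x ∷ v)))

  sumVecs-+ : ∀ N K (f g : Vec (Fin K) N → Carrier) → sumVecs N K (λ v → f v + g v) ≈ sumVecs N K f + sumVecs N K g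
  sumVecs-+ zero    K f g = refl
  sumVecs-+ (suc N) K f g = trans
    (sumVecs-cong N K (λ v → ∑-distrib-+ (λ x → f (x ∷ v)) (λ x → g (x ∷ v))))
    (sumVecs-+ N K (λ v → sum (λ x → f (x ∷ v))) (λ v → sum (λ x → g (x ∷ v))))

  sumVecs-* : ∀ N K x (f : Vec (Fin K) N → Carrier) → sumVecs N K (λ v → x * f v) ≈ x * sumVecs N K f
  sumVecs-* zero    K x f = refl
  sumVecs-* (suc N) K x f = trans
    (sumVecs-cong N K (λ v → sym (*-distribˡ-sum x (λ y → f (y ∷ v)))))
    (sumVecs-* N K x (λ v → sum (λ y → f (y ∷ v))))

  sumVecs-0 : ∀ N K (f : Vec (Fin K) N → Carrier) → (∀ v → f v ≈ 0#) → sumVecs N K f ≈ 0#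
  sumVecs-0 zero    K f f≈0 = f≈0 []
  sumVecs-0 (suc N) K f f≈0 = sumVecs-0 N K _ (λ v → sum-0 _ (λ x → f≈0 (x ∷ v)))

  sumVecs-sum : ∀ N K M (g : Fin M → Vec (Fin K) N → Carrier) →
    sumVecs N K (λ v → sum (λ x → g x v)) ≈ sum (λ x → sumVecs N K (g x))
  sumVecs-sum N K zero    g = sumVecs-0 N K _ (λ v → refl)
  sumVecs-sum N K (suc M) g = trans (sumVecs-+ N K _ _) (+-congˡ (sumVecs-sum N K M (g ∘ suc)))

  sumVecs-∷ : ∀ N K (f : Vec (Fin K) (suc N) → Carrier) → sumVecs (suc N) K f ≈ sum (λ x → sumVecs N K (λ v → f (x ∷ v)))
  sumVecs-∷ N K f = sumVecs-sum N K K (λ x v → f (x ∷ v))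

  sumList-allVecs : ∀ N K (f : Vec (Fin K) N → Carrier) → sumList R (map f (allVecs N K)) ≈ sumVecs N K f
  sumList-allVecs zero    K f = +-identityʳ _
  sumList-allVecs (suc N) K f = begin
    sumList R (map f (allVecs (suc N) K))
      ≈⟨ sumList-concatMap f (λ v → map (_∷ v) (allFin K)) (allVecs N K) ⟩
    sumList R (map (λ v → sumList R (map f (map (_∷ v) (allFin K)))) (allVecs N K))
      ≈⟨ sumList-map-cong (allVecs N K) (λ v → reflexive (cong (sumList R)
           (≡.trans (≡.sym (map-∘ (allFin K))) (map-tabulate id (f ∘ (_∷ v)))))) ⟩
    sumList R (map (λ v → sumList R (tabulate (λ x → f (x ∷ v)))) (allVecs N K))
      ≈⟨ sumList-map-cong (allVecs N K) (λ v → reflexive (sumList-tabulate (λ x → f (x ∷ v)))) ⟩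
    sumList R (map (λ v → sum (λ x → f (x ∷ v))) (allVecs N K))
      ≈⟨ sumList-allVecs N K _ ⟩
    sumVecs (suc N) K f ∎

  sumSubsets : (N : ℕ) → (Vec Bool N → Carrier) → Carrier
  sumSubsets zero    G = G []
  sumSubsets (suc N) G = sumSubsets N (λ S → G (true ∷ S)) + sumSubsets N (λ S → G (false ∷ S))

  sumSubsets-cong : ∀ N {f g : Vec Bool N → Carrier} → (∀ S → f S ≈ g S) → sumSubsets N f ≈ sumSubsets N g
  sumSubsets-cong zero    f≈g = f≈g []
  sumSubsets-cong (suc N) f≈g = +-cong (sumSubsets-cong N (f≈g ∘ (true ∷_))) (sumSubsets-cong N (f≈g ∘ (false ∷_)))

  sumSubsets-+ : ∀ N (f g : Vec Bool N → Carrier) → sumSubsets N (λ S → f S + g S) ≈ sumSubsets N f + sumSubsets N g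
  sumSubsets-+ zero    f g = refl
  sumSubsets-+ (suc N) f g = trans (+-cong (sumSubsets-+ N _ _) (sumSubsets-+ N _ _)) (interchange _ _ _ _)

  sumSubsets-0 : ∀ N (f : Vec Bool N → Carrier) → (∀ S → f S ≈ 0#) → sumSubsets N f ≈ 0#
  sumSubsets-0 zero    f f≈0 = f≈0 []
  sumSubsets-0 (suc N) f f≈0 =
    trans (+-cong (sumSubsets-0 N _ (f≈0 ∘ (true ∷_))) (sumSubsets-0 N _ (f≈0 ∘ (false ∷_)))) (+-identityˡ 0#)

  sumSubsets-sum : ∀ N M (g : Fin M → Vec Bool N → Carrier) →
    sumSubsets N (λ S → sum (λ x → g x S)) ≈ sum (λ x → sumSubsets N (g x))
  sumSubsets-sum N zero    g = sumSubsets-0 N _ (λ S → refl)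
  sumSubsets-sum N (suc M) g = trans (sumSubsets-+ N _ _) (+-congˡ (sumSubsets-sum N M (g ∘ suc)))

  sumVecs-merge : ∀ N K (f : Vec (Fin (suc K)) N → Carrier) →
    sumVecs N (suc K) f ≈ sumSubsets N (λ S → sumVecs (countFalse S) K (f ∘ merge S))
  sumVecs-merge zero    K f = refl
  sumVecs-merge (suc N) K f = begin
    sumVecs (suc N) (suc K) f
      ≈⟨ sumVecs-∷ N (suc K) f ⟩
    sumVecs N (suc K) (λ w → f (zero ∷ w)) + sum (λ y → sumVecs N (suc K) (λ w → f (suc y ∷ w)))
      ≈⟨ +-cong (sumVecs-merge N K (λ w → f (zero ∷ w))) (sum-cong-≋ (λ y → sumVecs-merge N K (λ w → f (suc y ∷ w)))) ⟩
    sumSubsets N (λ S → sumVecs (countFalse S) K (λ u → f (zero ∷ merge S u))) +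
      sum (λ y → sumSubsets N (λ S → sumVecs (countFalse S) K (λ u → f (suc y ∷ merge S u))))
      ≈⟨ +-congˡ (sumSubsets-sum N K _) ⟨
    sumSubsets N (λ S → sumVecs (countFalse S) K (λ u → f (zero ∷ merge S u))) +
      sumSubsets N (λ S → sum (λ y → sumVecs (countFalse S) K (λ u → f (suc y ∷ merge S u))))
      ≈⟨ +-congˡ (sumSubsets-cong N (λ S → sumVecs-∷ (countFalse S) K (f ∘ merge (false ∷ S)))) ⟨
    sumSubsets (suc N) (λ S → sumVecs (countFalse S) K (f ∘ merge S)) ∎

  sumSubsets-⋆ : ∀ N (f g : Seq) → sumSubsets N (λ S → f (countTrue S) * g (countFalse S)) ≈ (f ⋆ g) N
  sumSubsets-⋆ zero    f g = refl
  sumSubsets-⋆ (suc N) f g = +-cong (sumSubsets-⋆ N (∂ f) g) (sumSubsets-⋆ N f (∂ g))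

  sumSubsets-avoids : ∀ r m (G : Vec Bool (r ℕ.+ m) → Carrier) →
    sumSubsets (r ℕ.+ m) (λ S → if avoids r S then G S else 0#) ≈ sumSubsets m (G ∘ (Vec.replicate r false Vec.++_))
  sumSubsets-avoids zero    m G = refl
  sumSubsets-avoids (suc r) m G =
    trans (+-congʳ (sumSubsets-0 (r ℕ.+ m) _ (λ S → refl))) (trans (+-identityˡ _) (sumSubsets-avoids r m _))

module RBellRecurrence {c ℓ : Level} (R : CommutativeRing c ℓ) (a b : ℕ → CommutativeRing.Carrier R) where
  open CommutativeRing R hiding (zero)
  open import Relation.Binary.Reasoning.Setoid setoid
  open import Algebra.Properties.Semiring.Sum semiring using (sum)
  open RingArithmetic R using (prodFin-cong)
  open BinomialConvolution R using (∂; _⋆_)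
  open SumsOverLabellings R
  open Labellings

  B : ℕ → ℕ → ℕ → Carrier
  B N K r = rBell R N K r a b

  term : ∀ N K r → Vec (Fin K) N → Carrier
  term N K r v = if isRPartitionB N K r v then rWeight R N K r a b v else 0#

  term-suc-head : ∀ {N K} r (y : Fin K) (w : Vec (Fin (suc K)) N) → term (suc N) (suc K) r (suc y ∷ w) ≡ 0#
  term-suc-head {N} {K} r y w =
    cong (λ t → if t then rWeight R (suc N) (suc K) r a b (suc y ∷ w) else 0#) (isRPartition-suc-head r y w)

  B≈sumVecs : ∀ N K r → B N K r ≈ sumVecs N K (term N K r)
  B≈sumVecs N K r = sumList-allVecs N K (term N K r)

  B-0-0 : ∀ r → B 0 0 r ≈ 1#
  B-0-0 r = +-identityʳ 1#

  B-suc-0 : ∀ N r → B (suc N) 0 r ≈ 0#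
  B-suc-0 N r = trans (B≈sumVecs (suc N) 0 r) (sumVecs-0 N 0 _ (λ v → refl))

  B-0-suc : ∀ K r → B 0 (suc K) r ≈ 0#
  B-0-suc K r = +-identityʳ 0#

  B-first-block : ∀ N K r →
    B (suc N) (suc K) r ≈ sumSubsets N (λ S → sumVecs (countFalse S) K (λ u → term (suc N) (suc K) r (zero ∷ merge S u)))
  B-first-block N K r = begin
    B (suc N) (suc K) r
      ≈⟨ B≈sumVecs (suc N) (suc K) r ⟩
    sumVecs (suc N) (suc K) (term (suc N) (suc K) r)
      ≈⟨ sumVecs-∷ N (suc K) (term (suc N) (suc K) r) ⟩
    sumVecs N (suc K) (λ w → term (suc N) (suc K) r (zero ∷ w)) +
      sum (λ y → sumVecs N (suc K) (λ w → term (suc N) (suc K) r (suc y ∷ w)))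
      ≈⟨ +-congˡ (sum-0 _ (λ y → sumVecs-0 N (suc K) _ (λ w → reflexive (term-suc-head r y w)))) ⟩
    sumVecs N (suc K) (λ w → term (suc N) (suc K) r (zero ∷ w)) + 0#
      ≈⟨ +-identityʳ _ ⟩
    sumVecs N (suc K) (λ w → term (suc N) (suc K) r (zero ∷ w))
      ≈⟨ sumVecs-merge N K _ ⟩
    sumSubsets N (λ S → sumVecs (countFalse S) K (λ u → term (suc N) (suc K) r (zero ∷ merge S u))) ∎

  rWeight-merge : ∀ {N K} r (S : Vec Bool N) (u : Vec (Fin K) (countFalse S)) → avoids r S ≡ true →
    rWeight R (suc N) (suc K) (suc r) a b (zero ∷ merge S u) ≡ b (suc (countTrue S)) * rWeight R (countFalse S) K r a b u
  rWeight-merge {K = K} r S u av = cong₂ _*_ (cong (b ∘ suc) (blockSize-merge-zero S u))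
    (prodFin-cong K (λ β → cong₂ (λ t n → if t then b n else a n) (meets-merge-suc r S u β av) (blockSize-merge-suc S u β)))

  rWeight₀-merge : ∀ {N K} (S : Vec Bool N) (u : Vec (Fin K) (countFalse S)) →
    rWeight R (suc N) (suc K) 0 a b (zero ∷ merge S u) ≡ a (suc (countTrue S)) * rWeight R (countFalse S) K 0 a b u
  rWeight₀-merge {K = K} S u = cong₂ _*_
    (cong₂ (λ t n → if t then b n else a n) (meets₀ (zero ∷ merge S u) zero) (cong suc (blockSize-merge-zero S u)))
    (prodFin-cong K (λ β → cong₂ (λ t n → if t then b n else a n)
      (≡.trans (meets₀ (zero ∷ merge S u) (suc β)) (≡.sym (meets₀ u β))) (blockSize-merge-suc S u β)))

  if-then-*-else-0 : ∀ t x y → (if t then x * y else 0#) ≈ x * (if t then y else 0#)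
  if-then-*-else-0 true  x y = refl
  if-then-*-else-0 false x y = sym (zeroʳ x)

  term-merge : ∀ {N K} r (S : Vec Bool N) (u : Vec (Fin K) (countFalse S)) → avoids r S ≡ true →
    term (suc N) (suc K) (suc r) (zero ∷ merge S u) ≈ b (suc (countTrue S)) * term (countFalse S) K r u
  term-merge {K = K} r S u av = trans
    (reflexive (cong₂ (λ t w → if t then w else 0#)
      (≡.trans (isRPartition-merge r S u) (cong (_∧ isRPartitionB (countFalse S) K r u) av)) (rWeight-merge r S u av)))
    (if-then-*-else-0 (isRPartitionB (countFalse S) K r u) _ _)

  term-merge-blocked : ∀ {N K} r (S : Vec Bool N) (u : Vec (Fin K) (countFalse S)) → avoids r S ≡ false →
    term (suc N) (suc K) (suc r) (zero ∷ merge S u) ≡ 0#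
  term-merge-blocked {N} {K} r S u av =
    cong (λ t → if t then rWeight R (suc N) (suc K) (suc r) a b (zero ∷ merge S u) else 0#)
         (≡.trans (isRPartition-merge r S u) (cong (_∧ isRPartitionB (countFalse S) K r u) av))

  term₀-merge : ∀ {N K} (S : Vec Bool N) (u : Vec (Fin K) (countFalse S)) →
    term (suc N) (suc K) 0 (zero ∷ merge S u) ≈ a (suc (countTrue S)) * term (countFalse S) K 0 u
  term₀-merge S u = trans
    (reflexive (cong₂ (λ t w → if t then w else 0#) (isRPartition₀-merge S u) (rWeight₀-merge S u)))
    (if-then-*-else-0 (isRPartitionB (countFalse S) _ 0 u) _ _)

  sumVecs-term : ∀ {N K r r′} (S : Vec Bool N) x →
    (∀ u → term (suc N) (suc K) r (zero ∷ merge S u) ≈ x * term (countFalse S) K r′ u) →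
    sumVecs (countFalse S) K (λ u → term (suc N) (suc K) r (zero ∷ merge S u)) ≈ x * B (countFalse S) K r′
  sumVecs-term {K = K} {r′ = r′} S x factor = begin
    sumVecs (countFalse S) K _                               ≈⟨ sumVecs-cong (countFalse S) K factor ⟩
    sumVecs (countFalse S) K (λ u → x * term _ K r′ u)       ≈⟨ sumVecs-* (countFalse S) K x _ ⟩
    x * sumVecs (countFalse S) K (term (countFalse S) K r′)  ≈⟨ *-congˡ (B≈sumVecs (countFalse S) K r′) ⟨
    x * B (countFalse S) K r′                                ∎

  B-suc-recurrence : ∀ r m K → B (suc (r ℕ.+ m)) (suc K) (suc r) ≈ (∂ b ⋆ (λ k → B (r ℕ.+ k) K r)) m
  B-suc-recurrence r m K = begin
    B (suc (r ℕ.+ m)) (suc K) (suc r)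
      ≈⟨ B-first-block (r ℕ.+ m) K (suc r) ⟩
    sumSubsets (r ℕ.+ m) (λ S → sumVecs (countFalse S) K (λ u → term _ _ (suc r) (zero ∷ merge S u)))
      ≈⟨ sumSubsets-cong (r ℕ.+ m) first-block ⟩
    sumSubsets (r ℕ.+ m) (λ S → if avoids r S then b (suc (countTrue S)) * B (countFalse S) K r else 0#)
      ≈⟨ sumSubsets-avoids r m _ ⟩
    sumSubsets m (λ S → b (suc (countTrue (falses S))) * B (countFalse (falses S)) K r)
      ≈⟨ sumSubsets-cong m (λ S → reflexive
           (cong₂ (λ t f → b (suc t) * B f K r) (countTrue-falses r S) (countFalse-falses r S))) ⟩
    sumSubsets m (λ S → ∂ b (countTrue S) * B (r ℕ.+ countFalse S) K r)
      ≈⟨ sumSubsets-⋆ m (∂ b) (λ k → B (r ℕ.+ k) K r) ⟩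
    (∂ b ⋆ (λ k → B (r ℕ.+ k) K r)) m ∎
    where
    falses : Vec Bool m → Vec Bool (r ℕ.+ m)
    falses S = Vec.replicate r false Vec.++ S

    first-block : ∀ S → sumVecs (countFalse S) K (λ u → term _ _ (suc r) (zero ∷ merge S u)) ≈
                        (if avoids r S then b (suc (countTrue S)) * B (countFalse S) K r else 0#)
    first-block S with avoids r S in av
    ... | true  = sumVecs-term {r = suc r} {r′ = r} S (b (suc (countTrue S))) (λ u → term-merge r S u av)
    ... | false = sumVecs-0 (countFalse S) K _ (λ u → reflexive (term-merge-blocked r S u av))

  B₀-recurrence : ∀ m K → B (suc m) (suc K) 0 ≈ (∂ a ⋆ (λ k → B k K 0)) m
  B₀-recurrence m K = begin
    B (suc m) (suc K) 0
      ≈⟨ B-first-block m K 0 ⟩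
    sumSubsets m (λ S → sumVecs (countFalse S) K (λ u → term _ _ 0 (zero ∷ merge S u)))
      ≈⟨ sumSubsets-cong m (λ S → sumVecs-term {r = 0} {r′ = 0} S (a (suc (countTrue S))) (term₀-merge S)) ⟩
    sumSubsets m (λ S → ∂ a (countTrue S) * B (countFalse S) K 0)
      ≈⟨ sumSubsets-⋆ m (∂ a) (λ k → B k K 0) ⟩
    (∂ a ⋆ (λ k → B k K 0)) m ∎

module RBellMoments {c ℓ : Level} (R : CommutativeRing c ℓ) (μ : ℕ → CommutativeRing.Carrier R) where
  open CommutativeRing R hiding (zero)
  open import Relation.Binary.Reasoning.Setoid setoid
  open RingArithmetic R using (⟦_⟧)
  open BinomialConvolution R

  a : Seq
  a l = ⟦ l ⟧ * μ (l ∸ 1)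

  open RBellRecurrence R a 𝟙

  B₀≈γ : ∀ p N → B N p 0 ≈ γ μ p N
  B₀≈γ zero    N       = trans (B-no-blocks N) (sym (⋆-identityˡ (δ 0) N))
    where
    B-no-blocks : ∀ N → B N 0 0 ≈ δ 0 N
    B-no-blocks zero    = B-0-0 0
    B-no-blocks (suc N) = B-suc-0 N 0
  B₀≈γ (suc p) zero    = trans (B-0-suc p 0) (sym (zeroˡ _))
  B₀≈γ (suc p) (suc N) = begin
    B (suc N) (suc p) 0          ≈⟨ B₀-recurrence N p ⟩
    (∂ a ⋆ (λ k → B k p 0)) N    ≈⟨ ⋆-cong (λ k → sym (δ₁-⋆ μ (suc k))) (B₀≈γ p) N ⟩
    (∂ (δ 1 ⋆ μ) ⋆ γ μ p) N      ≈⟨ ∂-γ μ p N ⟩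
    γ μ (suc p) (suc N)          ∎

  B≈δ⋆shiftedMoments : ∀ q p n → B (q ℕ.+ n) (q ℕ.+ p) q ≈ (δ p ⋆ shiftedMoments μ p q) n
  B≈δ⋆shiftedMoments zero    p n = B₀≈γ p n
  B≈δ⋆shiftedMoments (suc q) p n = begin
    B (suc (q ℕ.+ n)) (suc (q ℕ.+ p)) (suc q)
      ≈⟨ B-suc-recurrence q n (q ℕ.+ p) ⟩
    (𝟙 ⋆ (λ k → B (q ℕ.+ k) (q ℕ.+ p) q)) n
      ≈⟨ ⋆-cong (λ _ → refl) (B≈δ⋆shiftedMoments q p) n ⟩
    (𝟙 ⋆ (δ p ⋆ shiftedMoments μ p q)) n
      ≈⟨ ⋆-swap 𝟙 (δ p) (shiftedMoments μ p q) n ⟩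
    (δ p ⋆ shiftedMoments μ p (suc q)) n ∎

open import Data.Nat using (_+_)

corollary2 : ∀ {a ℓa k ℓk : Level}
    (A : CommutativeRing a ℓa) (Kr : CommutativeRing k ℓk)
    (E : CommutativeRing.Carrier A → CommutativeRing.Carrier Kr)
    (E-cong : ∀ x y → CommutativeRing._≈_ A x y → CommutativeRing._≈_ Kr (E x) (E y))
    (E-+ : ∀ x y → CommutativeRing._≈_ Kr (E (CommutativeRing._+_ A x y)) (CommutativeRing._+_ Kr (E x) (E y)))
    (E-1 : CommutativeRing._≈_ Kr (E (CommutativeRing.1# A)) (CommutativeRing.1# Kr))
    (p q : ℕ) (X : Fin p → CommutativeRing.Carrier A) (μ : ℕ → CommutativeRing.Carrier Kr)
    (indep : ∀ (j : Fin p → ℕ) → CommutativeRing._≈_ Kr (E (prodFin A p (λ i → pow A (X i) (j i)))) (prodFin Kr p (λ i → μ (j i))))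
    (n : ℕ) →
    CommutativeRing._≈_ Kr
      (CommutativeRing._*_ Kr (ℕ→R Kr ((n + p) C p)) (E (pow A (CommutativeRing._+_ A (sumFin A p X) (ℕ→R A q)) n)))
      (rBell Kr (n + p + q) (p + q) q (λ l → CommutativeRing._*_ Kr (ℕ→R Kr l) (μ (l ∸ 1))) (λ l → CommutativeRing.1# Kr))
corollary2 A Kr E E-cong E-+ _ p q X μ indep n = begin
  ⟦ (n + p) C p ⟧ * E (pow A (sumFin A p X A.+ ℕ→R A q) n)
    ≈⟨ *-congˡ (E-pow-shifted-sum E E-cong E-+ p q X μ indep n) ⟩
  ⟦ (n + p) C p ⟧ * shiftedMoments μ p q n
    ≡⟨ cong (λ m → ⟦ (n + p) C p ⟧ * shiftedMoments μ p q m) (≡.sym (ℕ.m+n∸n≡m n p)) ⟩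
  ⟦ (n + p) C p ⟧ * shiftedMoments μ p q ((n + p) ∸ p)
    ≈⟨ δ-⋆ p (shiftedMoments μ p q) (n + p) ⟨
  (δ p ⋆ shiftedMoments μ p q) (n + p)
    ≈⟨ B≈δ⋆shiftedMoments q p (n + p) ⟨
  rBell Kr (q + (n + p)) (q + p) q a 𝟙
    ≡⟨ cong₂ (λ N K → rBell Kr N K q a 𝟙) (ℕ.+-comm q (n + p)) (ℕ.+-comm q p) ⟩
  rBell Kr (n + p + q) (p + q) q a 𝟙 ∎
  where
  module A = CommutativeRing A
  open CommutativeRing Kr using (_*_; *-congˡ; setoid)
  open import Relation.Binary.Reasoning.Setoid setoid
  open RingArithmetic Kr using (⟦_⟧)
  open BinomialConvolution Kr
  open Expectation A Kr
  open RBellMoments Kr μ
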